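{- Let $k\geq 1$ and $n\geq 2k+1$. For any connector $\{x,y\}$, the sequence $(x,f(x),y,f(y))$ is a $4$-cycle in the Kneser graph $K(n,k)$.
   Context: $X_{n,k}$ is the set of binary strings of length $n$ with exactly $k$ ones, identified with $k$-subsets of $[n]$; it is the vertex set of the Kneser graph $K(n,k)$, where two strings are adjacent iff they have no $1$ in a common position. Parenthesis matching: regarding $x$ cyclically, each $1$ is matched to the last $0$ of the shortest cyclic substring starting at this $1$ and going rightwards that contains equally many $0$s and $1$s; every $1$ is matched, and $n-2k$ zeros are unmatched. $f(x)$ is obtained from $x$ by complementing all matched bits. $D$ denotes the set of Dyck words (binary words with equally many $0$s and $1$s, every prefix having at least as many $1$s as $0$s). A matched pair (a $1$ and the $0$ it is matched to) is visible if it is not enclosed by any other matched pair. $\sigma^i$ denotes cyclic right shift by $i$ positions. A connector is an unordered pair $\{x,y\}$ of strings in $X_{n,k}$ of the form $x=\sigma^i(P\,1\,u\,0\,Q\,0\,w\,0\,R)$ and $y=\sigma^i(P\,0\,u\,0\,Q\,1\,w\,0\,R)$ for some $i\geq 0$, some binary words $P,Q,R$ (the same in $x$ and $y$) and $u,w\in D$, such that in $x$ the displayed $1$ and the $0$ after $u$ form a visible matched pair and the two displayed $0$s around $w$ are unmatched, while in $y$ the two displayed $0$s around $u$ are unmatched and the displayed $1$ and the $0$ after $w$ form a visible matched pair; i.e., $x$ and $y$ have the same matched pairs apart from this one visible pair. -}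

module Defs where

open import Data.Bool using (Bool; true; false; not; _∧_; _∨_; if_then_else_)
open import Data.Nat using (ℕ; zero; suc; _+_; _*_; _∸_; _≤_; _<_; _≡ᵇ_)
open import Data.Nat.DivMod using (_%_)
open import Data.List using (List; []; _∷_; _++_; length; drop; take; reverse; upTo; map)
open import Data.Bool.ListAction using (any)
open import Data.Maybe using (Maybe; just; nothing)
import Data.Maybe as Maybe
open import Data.Product using (Σ; _×_; _,_; ∃-syntax)
open import Data.Sum using (_⊎_)
open import Relation.Binary.PropositionalEquality using (_≡_)
open import Relation.Nullary using (¬_)

-- Binary strings are lists of booleans (true = 1, false = 0); positions are 0-based.

-- a mod n, with the convention a mod 0 = a (only used for n ≥ 1)
modN : ℕ → ℕ → ℕ
modN a zero = a
modN a (suc m) = a % suc m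

-- i-th entry (false outside the range)
nth : List Bool → ℕ → Bool
nth [] _ = false
nth (b ∷ _) zero = b
nth (_ ∷ bs) (suc i) = nth bs i

at : List Bool → ℕ → Bool
at x p = nth x (modN p (length x))

ones : List Bool → ℕ
ones [] = 0
ones (true ∷ bs) = suc (ones bs)
ones (false ∷ bs) = ones bs

X : ℕ → ℕ → List Bool → Set
X n k x = length x ≡ n × ones x ≡ k

rotL : ℕ → List Bool → List Bool
rotL j x = drop j x ++ take j x

-- closeAt c d w : scanning w with current depth c (number of unmatched 1s
-- since the start) and current offset d, return the offset at which the
-- depth first returns to 0.
closeAt : ℕ → ℕ → List Bool → Maybe ℕ
closeAt c d [] = nothing
closeAt c d (true ∷ w) = closeAt (suc c) (suc d) w
closeAt zero d (false ∷ w) = nothing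
closeAt (suc zero) d (false ∷ w) = just d
closeAt (suc (suc c)) d (false ∷ w) = closeAt (suc c) (suc d) w

-- parenthesis matching: if position a (cyclically) holds a 1, the position of
-- the 0 it is matched to, i.e. the last position of the shortest cyclic
-- substring starting at a, going rightwards, with equally many 0s and 1s.
mate : List Bool → ℕ → Maybe ℕ
mate x a with at x a
... | false = nothing
... | true = Maybe.map (λ d → modN (a + d) (length x))
                        (closeAt 1 1 (drop 1 (rotL (modN a (length x)) x)))

MatchedPair : List Bool → ℕ → ℕ → Set
MatchedPair x a b = a < length x × at x a ≡ true × mate x a ≡ just b

hits : List Bool → ℕ → ℕ → Bool
hits x p a with at x a | mate x a
... | true | just b = (a ≡ᵇ p) ∨ (b ≡ᵇ p)
... | _ | _ = false

matchedB : List Bool → ℕ → Bool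
matchedB x p = any (hits x p) (upTo (length x))

Unmatched : List Bool → ℕ → Set
Unmatched x p = matchedB x p ≡ false

f : List Bool → List Bool
f x = map (λ p → if matchedB x p then not (nth x p) else nth x p) (upTo (length x))

dyckFrom : ℕ → List Bool → Bool
dyckFrom c [] = c ≡ᵇ 0
dyckFrom c (true ∷ w) = dyckFrom (suc c) w
dyckFrom zero (false ∷ w) = false
dyckFrom (suc c) (false ∷ w) = dyckFrom c w

Dyck : List Bool → Set
Dyck w = dyckFrom 0 w ≡ true

cd : ℕ → ℕ → ℕ → ℕ
cd n a b = modN (b + n ∸ a) n

Encloses : ℕ → ℕ → ℕ → ℕ → ℕ → Set
Encloses n a' b' a b =
  (0 < cd n a' a × cd n a' a < cd n a' b') × (0 < cd n a' b × cd n a' b < cd n a' b')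

Visible : List Bool → ℕ → ℕ → Set
Visible x a b = MatchedPair x a b ×
  (∀ a' b' → MatchedPair x a' b' → ¬ Encloses (length x) a' b' a b)

rotR1 : List Bool → List Bool
rotR1 xs = go (reverse xs)
  where
  go : List Bool → List Bool
  go [] = []
  go (a ∷ r) = a ∷ reverse r

σ^ : ℕ → List Bool → List Bool
σ^ zero x = x
σ^ (suc i) x = rotR1 (σ^ i x)

Connector : ℕ → ℕ → List Bool → List Bool → Set
Connector n k x y =
  X n k x × X n k y ×
  Σ ℕ λ i → Σ (List Bool) λ P → Σ (List Bool) λ Q → Σ (List Bool) λ R →
  Σ (List Bool) λ u → Σ (List Bool) λ w →
    let p1 = length P
        p2 = p1 + 1 + length u
        p3 = p2 + 1 + length Q
        p4 = p3 + 1 + length w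
        s : ℕ → ℕ
        s p = modN (p + i) n
    in Dyck u × Dyck w ×
       x ≡ σ^ i (P ++ true ∷ u ++ false ∷ Q ++ false ∷ w ++ false ∷ R) ×
       y ≡ σ^ i (P ++ false ∷ u ++ false ∷ Q ++ true ∷ w ++ false ∷ R) ×
       Visible x (s p1) (s p2) × Unmatched x (s p3) × Unmatched x (s p4) ×
       Unmatched y (s p1) × Unmatched y (s p2) × Visible y (s p3) (s p4)

Adjacent : List Bool → List Bool → Set
Adjacent x y = ∀ p → ¬ (nth x p ≡ true × nth y p ≡ true)

FourCycle : ℕ → ℕ → List Bool → List Bool → List Bool → List Bool → Set
FourCycle n k a b c d =
  (X n k a × X n k b × X n k c × X n k d) ×
  (¬ a ≡ b × ¬ a ≡ c × ¬ a ≡ d × ¬ b ≡ c × ¬ b ≡ d × ¬ c ≡ d) ×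
  (Adjacent a b × Adjacent b c × Adjacent c d × Adjacent d a)

module Submission where

open import Defs
open import Data.Bool using (Bool; true; false; not; if_then_else_; T; _∨_)
import Data.Bool as Bool
open import Data.Bool.Properties using (¬-not; T-∨; T-≡)
open import Data.Empty using (⊥-elim)
open import Data.Fin as Fin using (Fin)
open import Data.Fin.Properties using (toℕ<n; toℕ-fromℕ<; toℕ-injective)
import Data.Fin.Properties as FinP
open import Data.List using (List; []; _∷_; _++_; _∷ʳ_; length; drop; take; map; upTo; applyUpTo)
open import Data.List.Membership.Propositional using (find; lose)
open import Data.List.Membership.Propositional.Properties using (∈-upTo⁺; ∈-upTo⁻)
open import Data.List.Properties
  using (length-++; ++-assoc; reverse-++; reverse-involutive; take++drop≡id; map-upTo; length-map; length-upTo)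
open import Data.List.Relation.Unary.Any.Properties using (any⁺; any⁻)
open import Data.Maybe using (Maybe; just; nothing)
import Data.Maybe as Maybe
open import Data.Maybe.Properties using (just-injective; ≡-dec)
open import Data.Nat using (ℕ; zero; suc; _+_; _*_; _∸_; _≤_; _<_; _%_; z≤n; s≤s; _≡ᵇ_)
open import Data.Nat.DivMod
open import Data.Nat.Properties
open import Algebra.Properties.CommutativeMonoid.Sum +-0-commutativeMonoid
  using (sum-syntax; sum-cong-≗; sum-replicate-zero; ∑-comm)
open import Data.Nat.Tactic.RingSolver using (solve-∀)
open import Data.Product using (∃; ∃-syntax; _×_; _,_; proj₁; proj₂)
open import Data.Sum using (_⊎_; inj₁; inj₂)
import Data.Sum as Sum
open import Function using (_∘_; _⇔_; Equivalence; mk⇔; case_of_)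
open import Function.Construct.Composition using (_⇔-∘_)
open import Relation.Binary.Definitions using (tri<; tri≈; tri>)
open import Relation.Binary.PropositionalEquality
open import Relation.Nullary using (Dec; yes; no; ¬_)
import Relation.Unary as U

-- In a word with at most half of its bits equal to 1, every 1 has a mate, and the
-- mate map is injective because matched pairs nest like parentheses: two 1s with the
-- same closing 0 would give crossing intervals.  Hence f flips every 1 to 0 and
-- exactly as many 0s to 1, so f x ∈ X n k, and f x is adjacent to x.
-- In a connector, y is x with the 1 at p1 moved to p3, an unmatched 0 of x.  So every
-- 1 of y is a 1 of x or an unmatched 0 of x, both 0 in f x: f x ~ y, and symmetrically
-- f y ~ x.  The diagonals are distinct: x and y differ at p1, and f x and f y differ
-- at p2, which is matched in x but an unmatched 0 in y.

zeros : List Bool → ℕ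
zeros [] = 0
zeros (true ∷ w) = zeros w
zeros (false ∷ w) = suc (zeros w)

length≡ones+zeros : ∀ w → length w ≡ ones w + zeros w
length≡ones+zeros [] = refl
length≡ones+zeros (true ∷ w) = cong suc (length≡ones+zeros w)
length≡ones+zeros (false ∷ w) = trans (cong suc (length≡ones+zeros w)) (sym (+-suc (ones w) (zeros w)))

ones-++ : ∀ u v → ones (u ++ v) ≡ ones u + ones v
ones-++ [] v = refl
ones-++ (true ∷ u) v = cong suc (ones-++ u v)
ones-++ (false ∷ u) v = ones-++ u v

nth-≥ : ∀ z {p} → length z ≤ p → nth z p ≡ false
nth-≥ [] _ = refl
nth-≥ (b ∷ z) {suc p} (s≤s le) = nth-≥ z le

nth-true⇒< : ∀ z {p} → nth z p ≡ true → p < length z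
nth-true⇒< [] ()
nth-true⇒< (b ∷ z) {zero} _ = s≤s z≤n
nth-true⇒< (b ∷ z) {suc p} eq = s≤s (nth-true⇒< z eq)

nth-at-length : ∀ A {b} B → nth (A ++ b ∷ B) (length A) ≡ b
nth-at-length [] B = refl
nth-at-length (a ∷ A) B = nth-at-length A B

nth-at-length₂ : ∀ A {b} B {c} C → nth (A ++ b ∷ B ++ c ∷ C) (suc (length A + length B)) ≡ c
nth-at-length₂ [] B C = nth-at-length B C
nth-at-length₂ (a ∷ A) B C = nth-at-length₂ A B C

nth-edit : ∀ A B {b b′} t → t ≡ length A ⊎ nth (A ++ b ∷ B) t ≡ nth (A ++ b′ ∷ B) t
nth-edit [] B zero = inj₁ refl
nth-edit [] B (suc t) = inj₂ refl
nth-edit (a ∷ A) B zero = inj₂ refl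
nth-edit (a ∷ A) B (suc t) = Sum.map₁ (cong suc) (nth-edit A B t)

nth-edit₂ : ∀ A B C {b b′ c c′} t →
            t ≡ length A ⊎ t ≡ suc (length A + length B) ⊎ nth (A ++ b ∷ B ++ c ∷ C) t ≡ nth (A ++ b′ ∷ B ++ c′ ∷ C) t
nth-edit₂ [] B C zero = inj₁ refl
nth-edit₂ [] B C (suc t) = inj₂ (Sum.map₁ (cong suc) (nth-edit B C t))
nth-edit₂ (a ∷ A) B C zero = inj₂ (inj₂ refl)
nth-edit₂ (a ∷ A) B C (suc t) = Sum.map (cong suc) (Sum.map₁ (cong suc)) (nth-edit₂ A B C t)

segment : (ℕ → Bool) → ℕ → ℕ → List Bool
segment c s zero = []
segment c s (suc l) = c s ∷ segment c (suc s) l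

length-segment : ∀ c s l → length (segment c s l) ≡ l
length-segment c s zero = refl
length-segment c s (suc l) = cong suc (length-segment c (suc s) l)

segment-cong : ∀ c c′ s s′ l → (∀ t → t < l → c (s + t) ≡ c′ (s′ + t)) → segment c s l ≡ segment c′ s′ l
segment-cong c c′ s s′ zero _ = refl
segment-cong c c′ s s′ (suc l) eq = cong₂ _∷_ head-eq (segment-cong c c′ (suc s) (suc s′) l tail-eq)
  where
  head-eq : c s ≡ c′ s′
  head-eq = subst₂ (λ p p′ → c p ≡ c′ p′) (+-identityʳ s) (+-identityʳ s′) (eq 0 (s≤s z≤n))
  tail-eq : ∀ t → t < l → c (suc s + t) ≡ c′ (suc s′ + t)
  tail-eq t t<l = subst₂ (λ p p′ → c p ≡ c′ p′) (+-suc s t) (+-suc s′ t) (eq (suc t) (s≤s t<l))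

segment-++ : ∀ c s l₁ l₂ → segment c s (l₁ + l₂) ≡ segment c s l₁ ++ segment c (s + l₁) l₂
segment-++ c s zero l₂ = cong (λ s′ → segment c s′ l₂) (sym (+-identityʳ s))
segment-++ c s (suc l₁) l₂ =
  cong (c s ∷_) (trans (segment-++ c (suc s) l₁ l₂) (cong (λ s′ → segment c (suc s) l₁ ++ segment c s′ l₂) (sym (+-suc s l₁))))

nth-segment : ∀ c s l t → t < l → nth (segment c s l) t ≡ c (s + t)
nth-segment c s (suc l) zero _ = cong c (sym (+-identityʳ s))
nth-segment c s (suc l) (suc t) (s≤s t<l) = trans (nth-segment c (suc s) l t t<l) (cong c (sym (+-suc s t)))

drop-segment : ∀ c s l j → j ≤ l → drop j (segment c s l) ≡ segment c (s + j) (l ∸ j)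
drop-segment c s l zero _ = cong (λ s′ → segment c s′ l) (sym (+-identityʳ s))
drop-segment c s (suc l) (suc j) (s≤s j≤l) = trans (drop-segment c (suc s) l j j≤l) (cong (λ s′ → segment c s′ (l ∸ j)) (sym (+-suc s j)))

take-segment : ∀ c s l j → j ≤ l → take j (segment c s l) ≡ segment c s j
take-segment c s l zero _ = refl
take-segment c s (suc l) (suc j) (s≤s j≤l) = cong (c s ∷_) (take-segment c (suc s) l j j≤l)

segment-nth : ∀ z → z ≡ segment (nth z) 0 (length z)
segment-nth [] = refl
segment-nth (b ∷ z) = cong (b ∷_) (trans (segment-nth z) (segment-cong (nth z) (nth (b ∷ z)) 0 1 (length z) (λ _ _ → refl)))

closeAt-bounds : ∀ c d w {r} → closeAt c d w ≡ just r → d ≤ r × r < d + length w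
closeAt-bounds c d (true ∷ w) {r} eq =
  let d<r , r<1+d+w = closeAt-bounds (suc c) (suc d) w eq
  in <⇒≤ d<r , subst (r <_) (sym (+-suc d (length w))) r<1+d+w
closeAt-bounds (suc zero) d (false ∷ w) refl = ≤-refl , m<m+n d (s≤s z≤n)
closeAt-bounds (suc (suc c)) d (false ∷ w) {r} eq =
  let d<r , r<1+d+w = closeAt-bounds (suc c) (suc d) w eq
  in <⇒≤ d<r , subst (r <_) (sym (+-suc d (length w))) r<1+d+w

closeAt-at-zero : ∀ c d w {r} → closeAt c d w ≡ just r → ∃[ j ] r ≡ d + j × nth w j ≡ false
closeAt-at-zero c d (true ∷ w) eq =
  let j , r≡ , wj = closeAt-at-zero (suc c) (suc d) w eq in suc j , trans r≡ (sym (+-suc d j)) , wj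
closeAt-at-zero (suc zero) d (false ∷ w) refl = 0 , sym (+-identityʳ d) , refl
closeAt-at-zero (suc (suc c)) d (false ∷ w) eq =
  let j , r≡ , wj = closeAt-at-zero (suc c) (suc d) w eq in suc j , trans r≡ (sym (+-suc d j)) , wj

closeAt-shift : ∀ c e d w → closeAt c (e + d) w ≡ Maybe.map (e +_) (closeAt c d w)
closeAt-shift c e d [] = refl
closeAt-shift c e d (true ∷ w) = trans (cong (λ d′ → closeAt (suc c) d′ w) (sym (+-suc e d))) (closeAt-shift (suc c) e (suc d) w)
closeAt-shift zero e d (false ∷ w) = refl
closeAt-shift (suc zero) e d (false ∷ w) = refl
closeAt-shift (suc (suc c)) e d (false ∷ w) = trans (cong (λ d′ → closeAt (suc c) d′ w) (sym (+-suc e d))) (closeAt-shift (suc c) e (suc d) w)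

closeAt-++ : ∀ c d u v {r} → closeAt c d u ≡ just r → closeAt c d (u ++ v) ≡ just r
closeAt-++ c d (true ∷ u) v eq = closeAt-++ (suc c) (suc d) u v eq
closeAt-++ (suc zero) d (false ∷ u) v eq = eq
closeAt-++ (suc (suc c)) d (false ∷ u) v eq = closeAt-++ (suc c) (suc d) u v eq

closeAt-resume : ∀ c d u v {r} → closeAt (suc c) d (u ++ v) ≡ just r → d + length u ≤ r →
                 ∃[ c′ ] closeAt (suc c′) (d + length u) v ≡ just r
closeAt-resume c d [] v eq _ = c , subst (λ d′ → closeAt (suc c) d′ v ≡ just _) (sym (+-identityʳ d)) eq
closeAt-resume c d (true ∷ u) v {r} eq le =
  let c′ , eq′ = closeAt-resume (suc c) (suc d) u v eq (subst (_≤ r) (+-suc d (length u)) le)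
  in c′ , subst (λ d′ → closeAt (suc c′) d′ v ≡ just r) (sym (+-suc d (length u))) eq′
closeAt-resume zero d (false ∷ u) v refl le = ⊥-elim (m+n≮m d _ (subst (_≤ d) (+-suc d (length u)) le))
closeAt-resume (suc c) d (false ∷ u) v {r} eq le =
  let c′ , eq′ = closeAt-resume c (suc d) u v eq (subst (_≤ r) (+-suc d (length u)) le)
  in c′ , subst (λ d′ → closeAt (suc c′) d′ v ≡ just r) (sym (+-suc d (length u))) eq′

closeAt-deeper : ∀ a b d w {r} → closeAt (suc (suc (a + b))) d w ≡ just r →
                 ∃[ r′ ] closeAt (suc a) d w ≡ just r′ × r′ < r
closeAt-deeper a b d (true ∷ w) eq = closeAt-deeper (suc a) b (suc d) w eq
closeAt-deeper zero b d (false ∷ w) eq = d , refl , proj₁ (closeAt-bounds _ _ w eq)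
closeAt-deeper (suc a) b d (false ∷ w) eq = closeAt-deeper a b (suc d) w eq

closeAt-exists : ∀ c d w → ones w + suc c ≤ zeros w → ∃[ r ] closeAt (suc c) d w ≡ just r
closeAt-exists c d (true ∷ w) le = closeAt-exists (suc c) (suc d) w (subst (_≤ zeros w) (sym (+-suc (ones w) (suc c))) le)
closeAt-exists zero d (false ∷ w) le = d , refl
closeAt-exists (suc c) d (false ∷ w) le = closeAt-exists c (suc d) w (≤-pred (subst (_≤ suc (zeros w)) (+-suc (ones w) (suc c)) le))

-- Matched pairs nest: a 1 read inside a scan is closed strictly before the scan closes.
closeAt-nested : ∀ u v {d} → closeAt 1 1 (u ++ true ∷ v) ≡ just d → length u < d →
                 ∃[ d′ ] closeAt 1 1 v ≡ just d′ × suc (length u) + d′ < d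
closeAt-nested u v eq lu<d with closeAt-resume 0 1 u (true ∷ v) eq lu<d
... | c′ , resumed with closeAt-deeper 0 c′ (suc (suc (length u))) v resumed
...   | r′ , inner , r′<d = close (closeAt 1 1 v) refl
  where
  shifted : Maybe.map (suc (length u) +_) (closeAt 1 1 v) ≡ just r′
  shifted = trans (sym (closeAt-shift 1 (suc (length u)) 1 v))
                  (trans (cong (λ d′ → closeAt 1 d′ v) (+-comm (suc (length u)) 1)) inner)
  close : ∀ r → closeAt 1 1 v ≡ r → ∃[ d′ ] closeAt 1 1 v ≡ just d′ × suc (length u) + d′ < _
  close (just d′) eq′ = d′ , eq′ , subst (_< _) (sym (just-injective (trans (sym (cong (Maybe.map _) eq′)) shifted))) r′<d
  close nothing eq′ with () ← trans (sym (cong (Maybe.map _) eq′)) shifted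

-- Cyclic words and mates

module Modular (m : ℕ) where

  N : ℕ
  N = suc m

  [p%N+t]%N≡[p+t]%N : ∀ p t → (p % N + t) % N ≡ (p + t) % N
  [p%N+t]%N≡[p+t]%N p t = begin
    (p % N + t) % N          ≡⟨ %-distribˡ-+ (p % N) t N ⟩
    (p % N % N + t % N) % N  ≡⟨ cong (λ r → (r + t % N) % N) (m%n%n≡m%n p N) ⟩
    (p % N + t % N) % N      ≡⟨ %-distribˡ-+ p t N ⟨
    (p + t) % N              ∎
    where open ≡-Reasoning

  [r+t]%N≢r : ∀ {r t} → r < N → 0 < t → t < N → (r + t) % N ≢ r
  [r+t]%N≢r {r} {t} r<N 0<t t<N eq with r + t <? N
  ... | yes r+t<N = <-irrefl (sym (trans (sym (m<n⇒m%n≡m r+t<N)) eq)) (m<m+n r 0<t)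
  ... | no r+t≮N = <-irrefl u≡r u<r
    where
    u = r + t ∸ N
    u+N≡r+t : u + N ≡ r + t
    u+N≡r+t = m∸n+n≡m (≮⇒≥ r+t≮N)
    u<r : u < r
    u<r = +-cancelʳ-< N u r (subst (_< r + N) (sym u+N≡r+t) (+-monoʳ-< r t<N))
    u≡r : u ≡ r
    u≡r = begin
      u                ≡⟨ m<n⇒m%n≡m (<-trans u<r r<N) ⟨
      u % N            ≡⟨ [m+n]%n≡m%n u N ⟨
      (u + N) % N      ≡⟨ cong (_% N) u+N≡r+t ⟩
      (r + t) % N      ≡⟨ eq ⟩
      r                ∎
      where open ≡-Reasoning

  %-injective-window : ∀ {p q} → p < q → q < p + N → p % N ≢ q % N
  %-injective-window {p} {q} p<q q<p+N eq =
    [r+t]%N≢r (m%n<n p N) (m<n⇒0<n∸m p<q) (+-cancelˡ-< p _ _ (subst (_< p + N) (sym p+t≡q) q<p+N)) shifted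
    where
    t = q ∸ p
    p+t≡q : p + t ≡ q
    p+t≡q = m+[n∸m]≡n (<⇒≤ p<q)
    shifted : (p % N + t) % N ≡ p % N
    shifted = trans ([p%N+t]%N≡[p+t]%N p t) (trans (cong (_% N) p+t≡q) (sym eq))

  [a+N+d]%N≡[a+d]%N : ∀ a d → (a + N + d) % N ≡ (a + d) % N
  [a+N+d]%N≡[a+d]%N a d = trans (cong (_% N) (trans (+-assoc a N d) (trans (cong (a +_) (+-comm N d)) (sym (+-assoc a d N)))))
                        ([m+n]%n≡m%n (a + d) N)

  [s+t%N]%N≡[s+t]%N : ∀ s t → (s + t % N) % N ≡ (s + t) % N
  [s+t%N]%N≡[s+t]%N s t = trans (cong (_% N) (+-comm s (t % N))) (trans ([p%N+t]%N≡[p+t]%N t s) (cong (_% N) (+-comm t s)))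

  shift-surjective : ∀ i {q} → q < N → ∃[ t ] t < N × (t + i) % N ≡ q
  shift-surjective i {q} q<N = (q + (N ∸ i % N)) % N , m%n<n (q + (N ∸ i % N)) N , (begin
    ((q + (N ∸ i % N)) % N + i) % N   ≡⟨ [p%N+t]%N≡[p+t]%N (q + (N ∸ i % N)) i ⟩
    (q + (N ∸ i % N) + i) % N         ≡⟨ [s+t%N]%N≡[s+t]%N (q + (N ∸ i % N)) i ⟨
    (q + (N ∸ i % N) + i % N) % N     ≡⟨ cong (_% N) (+-assoc q (N ∸ i % N) (i % N)) ⟩
    (q + (N ∸ i % N + i % N)) % N     ≡⟨ cong (λ r → (q + r) % N) (m∸n+n≡m (<⇒≤ (m%n<n i N))) ⟩
    (q + N) % N                       ≡⟨ [m+n]%n≡m%n q N ⟩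
    q % N                             ≡⟨ m<n⇒m%n≡m q<N ⟩
    q                                 ∎)
    where open ≡-Reasoning

mate-nothing : ∀ z {a} → at z a ≡ false → mate z a ≡ nothing
mate-nothing z za rewrite za = refl

at-mate : ∀ z {a b} → mate z a ≡ just b → at z a ≡ true
at-mate z {a} ma with at z a Bool.≟ true
... | yes za = za
... | no za with () ← trans (sym (mate-nothing z (¬-not za))) ma

rotR1-∷ʳ : ∀ (A : List Bool) x → rotR1 (A ∷ʳ x) ≡ x ∷ A
rotR1-∷ʳ A x rewrite reverse-++ A (x ∷ []) = cong (x ∷_) (reverse-involutive A)

module CyclicWord (z : List Bool) {m : ℕ} (length-z : length z ≡ suc m) where

  open Modular m public

  at-% : ∀ p → at z p ≡ nth z (p % N)
  at-% p = cong (λ L → nth z (modN p L)) length-z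

  at-≡-mod : ∀ {p q} → p % N ≡ q % N → at z p ≡ at z q
  at-≡-mod {p} {q} eq = trans (at-% p) (trans (cong (nth z) eq) (sym (at-% q)))

  at-< : ∀ {p} → p < N → at z p ≡ nth z p
  at-< {p} p<N = trans (at-% p) (cong (nth z) (m<n⇒m%n≡m p<N))

  at-+N : ∀ p → at z (p + N) ≡ at z p
  at-+N p = at-≡-mod ([m+n]%n≡m%n p N)

  z≡segment : z ≡ segment (nth z) 0 N
  z≡segment = trans (segment-nth z) (cong (segment (nth z) 0) length-z)

  rotL-segment : ∀ {j} → j < N → rotL j z ≡ segment (at z) j N
  rotL-segment {j} j<N = begin
    drop j z ++ take j z
      ≡⟨ cong₂ (λ u v → drop j u ++ take j v) z≡segment z≡segment ⟩
    drop j (segment (nth z) 0 N) ++ take j (segment (nth z) 0 N)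
      ≡⟨ cong₂ _++_ (drop-segment (nth z) 0 N j j≤N) (take-segment (nth z) 0 N j j≤N) ⟩
    segment (nth z) j (N ∸ j) ++ segment (nth z) 0 j
      ≡⟨ cong₂ _++_ (segment-cong _ _ _ _ _ λ t t<N∸j → sym (at-< (before t t<N∸j)))
                    (segment-cong _ _ _ _ _ λ t t<j → sym (trans (at-≡-mod (after t)) (at-< (<-trans t<j j<N)))) ⟩
    segment (at z) j (N ∸ j) ++ segment (at z) (j + (N ∸ j)) j
      ≡⟨ segment-++ (at z) j (N ∸ j) j ⟨
    segment (at z) j (N ∸ j + j)
      ≡⟨ cong (segment (at z) j) (m∸n+n≡m j≤N) ⟩
    segment (at z) j N ∎
    where
    open ≡-Reasoning
    j≤N = <⇒≤ j<N
    before : ∀ t → t < N ∸ j → j + t < N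
    before t t<N∸j = subst (j + t <_) (m+[n∸m]≡n j≤N) (+-monoʳ-< j t<N∸j)
    after : ∀ t → (j + (N ∸ j) + t) % N ≡ t % N
    after t = trans (cong (λ p → (p + t) % N) (m+[n∸m]≡n j≤N)) (trans (cong (_% N) (+-comm N t)) ([m+n]%n≡m%n t N))

  at-segment : ∀ s t → at (segment (at z) s N) t ≡ at z (s + t)
  at-segment s t = begin
    nth (segment (at z) s N) (modN t (length (segment (at z) s N)))
      ≡⟨ cong (λ L → nth (segment (at z) s N) (modN t L)) (length-segment (at z) s N) ⟩
    nth (segment (at z) s N) (t % N)
      ≡⟨ nth-segment (at z) s N (t % N) (m%n<n t N) ⟩
    at z (s + t % N)
      ≡⟨ at-≡-mod ([s+t%N]%N≡[s+t]%N s t) ⟩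
    at z (s + t) ∎
    where open ≡-Reasoning

  rotR1-segment : rotR1 z ≡ segment (at z) m N
  rotR1-segment = begin
    rotR1 z
      ≡⟨ cong rotR1 (trans z≡segment (trans (cong (segment (nth z) 0) (+-comm 1 m)) (segment-++ (nth z) 0 m 1))) ⟩
    rotR1 (segment (nth z) 0 m ∷ʳ nth z m)
      ≡⟨ rotR1-∷ʳ (segment (nth z) 0 m) (nth z m) ⟩
    nth z m ∷ segment (nth z) 0 m
      ≡⟨ cong₂ _∷_ (sym (at-< ≤-refl)) (segment-cong _ _ _ _ _ λ t t<m → sym (trans (cong (at z) (+-comm N t)) (trans (at-+N t) (at-< (<-trans t<m ≤-refl))))) ⟩
    segment (at z) m N ∎
    where open ≡-Reasoning

  length-rotR1 : length (rotR1 z) ≡ N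
  length-rotR1 = trans (cong length rotR1-segment) (length-segment (at z) m N)

  at-rotR1 : ∀ t → at (rotR1 z) (suc t) ≡ at z t
  at-rotR1 t = begin
    at (rotR1 z) (suc t)               ≡⟨ cong (λ v → at v (suc t)) rotR1-segment ⟩
    at (segment (at z) m N) (suc t)    ≡⟨ at-segment m (suc t) ⟩
    at z (m + suc t)                   ≡⟨ cong (at z) (trans (+-suc m t) (+-comm N t)) ⟩
    at z (t + N)                       ≡⟨ at-+N t ⟩
    at z t                             ∎
    where open ≡-Reasoning

  ones-rotL : ∀ j → ones (rotL j z) ≡ ones z
  ones-rotL j = begin
    ones (drop j z ++ take j z)         ≡⟨ ones-++ (drop j z) (take j z) ⟩
    ones (drop j z) + ones (take j z)   ≡⟨ +-comm (ones (drop j z)) _ ⟩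
    ones (take j z) + ones (drop j z)   ≡⟨ ones-++ (take j z) (drop j z) ⟨
    ones (take j z ++ drop j z)         ≡⟨ cong ones (take++drop≡id j z) ⟩
    ones z                              ∎
    where open ≡-Reasoning

  ones-segment : ∀ a → ones (segment (at z) a N) ≡ ones z
  ones-segment a = begin
    ones (segment (at z) a N)          ≡⟨ cong ones (segment-cong (at z) (at z) (a % N) a N λ t _ → at-≡-mod ([p%N+t]%N≡[p+t]%N a t)) ⟨
    ones (segment (at z) (a % N) N)    ≡⟨ cong ones (rotL-segment (m%n<n a N)) ⟨
    ones (rotL (a % N) z)              ≡⟨ ones-rotL (a % N) ⟩
    ones z                             ∎
    where open ≡-Reasoning

  scan : ℕ → Maybe ℕ
  scan a = closeAt 1 1 (segment (at z) (suc a) m)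

  mate-scan : ∀ {a} → at z a ≡ true → mate z a ≡ Maybe.map (λ d → (a + d) % N) (scan a)
  mate-scan {a} za rewrite za =
    trans (cong (λ L → Maybe.map (λ d → modN (a + d) L) (closeAt 1 1 (drop 1 (rotL (modN a L) z)))) length-z)
          (cong (λ w → Maybe.map (λ d → (a + d) % N) (closeAt 1 1 (drop 1 w)))
                (trans (rotL-segment (m%n<n a N)) (segment-cong _ _ _ _ _ λ t _ → at-≡-mod ([p%N+t]%N≡[p+t]%N a t))))

  mate-just : ∀ {a b} → mate z a ≡ just b → at z a ≡ true × ∃[ d ] scan a ≡ just d × b ≡ (a + d) % N
  mate-just {a} eq with at z a Bool.≟ true
  ... | no za with () ← trans (sym (mate-nothing z (¬-not za))) eq
  ... | yes za with scan a in sa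
  ...   | just d = za , d , refl , just-injective (trans (sym eq) (trans (mate-scan za) (cong (Maybe.map _) sa)))
  ...   | nothing with () ← trans (sym eq) (trans (mate-scan za) (cong (Maybe.map _) sa))

  scan-+N : ∀ a → scan (a + N) ≡ scan a
  scan-+N a = cong (closeAt 1 1) (segment-cong (at z) (at z) (suc (a + N)) (suc a) m λ t _ → at-≡-mod (shift t))
    where
    shift : ∀ t → (suc (a + N) + t) % N ≡ (suc a + t) % N
    shift t = trans (cong (_% N) (trans (cong suc (+-assoc a N t)) (cong (λ p → suc (a + p)) (+-comm N t))))
                    (trans (cong (_% N) (cong suc (sym (+-assoc a t N)))) ([m+n]%n≡m%n (suc a + t) N))

  scan-bounds : ∀ {a d} → scan a ≡ just d → 1 ≤ d × d ≤ m
  scan-bounds {a} {d} eq =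
    let 1≤d , d<1+m = closeAt-bounds 1 1 (segment (at z) (suc a) m) eq
    in 1≤d , ≤-pred (subst (d <_) (cong suc (length-segment (at z) (suc a) m)) d<1+m)

  scan-closes-at-zero : ∀ {a d} → scan a ≡ just d → at z (a + d) ≡ false
  scan-closes-at-zero {a} {d} eq with closeAt-at-zero 1 1 (segment (at z) (suc a) m) eq
  ... | j , refl , zj = begin
    at z (a + suc j)                          ≡⟨ cong (at z) (+-suc a j) ⟩
    at z (suc a + j)                          ≡⟨ nth-segment (at z) (suc a) m j j<m ⟨
    nth (segment (at z) (suc a) m) j          ≡⟨ zj ⟩
    false                                     ∎
    where
    open ≡-Reasoning
    j<m : j < m
    j<m = proj₂ (scan-bounds eq)

  scan-nested : ∀ {a e d d′} → scan a ≡ just d → 0 < e → e < d → at z (a + e) ≡ true →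
                scan (a + e) ≡ just d′ → e + d′ < d
  scan-nested {a} {suc e} {d} {d′} sa _ e<d za+e sa+e = subst (λ d″ → suc e + d″ < d) d″≡d′ inner<d
    where
    r = m ∸ suc e
    e+1+r≡m : e + suc r ≡ m
    e+1+r≡m = trans (+-suc e r) (m+[n∸m]≡n (≤-trans (<⇒≤ e<d) (proj₂ (scan-bounds sa))))
    u = segment (at z) (suc a) e
    v = segment (at z) (suc (a + suc e)) r
    split : segment (at z) (suc a) m ≡ u ++ true ∷ v
    split = begin
      segment (at z) (suc a) m
        ≡⟨ cong (segment (at z) (suc a)) e+1+r≡m ⟨
      segment (at z) (suc a) (e + suc r)
        ≡⟨ segment-++ (at z) (suc a) e (suc r) ⟩
      u ++ at z (suc a + e) ∷ segment (at z) (suc (suc a + e)) r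
        ≡⟨ cong (λ p → u ++ at z p ∷ segment (at z) (suc p) r) (sym (+-suc a e)) ⟩
      u ++ at z (a + suc e) ∷ v
        ≡⟨ cong (λ b → u ++ b ∷ v) za+e ⟩
      u ++ true ∷ v ∎
      where open ≡-Reasoning
    nested = closeAt-nested u v (subst (λ w → closeAt 1 1 w ≡ just d) split sa)
                            (subst (_< d) (sym (length-segment (at z) (suc a) e)) (<⇒≤ e<d))
    d″ = proj₁ nested
    inner<d : suc e + d″ < d
    inner<d = subst (λ l → suc l + d″ < d) (length-segment (at z) (suc a) e) (proj₂ (proj₂ nested))
    extends : segment (at z) (suc (a + suc e)) m ≡ v ++ segment (at z) (suc (a + suc e) + r) (suc e)
    extends = trans (cong (segment (at z) (suc (a + suc e))) (trans (sym e+1+r≡m) (+-comm e (suc r))))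
                    (trans (cong (segment (at z) (suc (a + suc e))) (sym (+-suc r e))) (segment-++ (at z) _ r (suc e)))
    d″≡d′ : d″ ≡ d′
    d″≡d′ = just-injective (trans (sym (trans (cong (closeAt 1 1) extends) (closeAt-++ 1 1 v _ (proj₁ (proj₂ nested))))) sa+e)

  mate-target : ∀ {a b} → mate z a ≡ just b → b < N × nth z b ≡ false
  mate-target {a} eq with mate-just eq
  ... | _ , d , sa , refl = m%n<n (a + d) N , trans (sym (at-% (a + d))) (scan-closes-at-zero sa)

  -- The m bits after a 1 hold ones z ∸ 1 ones, hence (as 2 * ones z ≤ N) more 0s than 1s.
  scan-exists : 2 * ones z ≤ N → ∀ {a} → at z a ≡ true → ∃[ d ] scan a ≡ just d
  scan-exists 2k≤N {a} za = closeAt-exists 0 1 w (subst (_≤ zeros w) (+-comm 1 o) 1+o≤zeros)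
    where
    w = segment (at z) (suc a) m
    o = ones w
    1+o≡k : suc o ≡ ones z
    1+o≡k = trans (cong (λ b → ones (b ∷ w)) (sym za)) (ones-segment a)
    m≡o+zeros : m ≡ o + zeros w
    m≡o+zeros = trans (sym (length-segment (at z) (suc a) m)) (length≡ones+zeros w)
    2[1+o]≤1+m : suc o + suc o ≤ suc (o + zeros w)
    2[1+o]≤1+m = subst₂ _≤_ (trans (cong (2 *_) (sym 1+o≡k)) (cong (suc o +_) (+-identityʳ (suc o))))
                            (cong suc m≡o+zeros) 2k≤N
    1+o≤zeros : suc o ≤ zeros w
    1+o≤zeros = +-cancelˡ-≤ o _ _ (≤-pred 2[1+o]≤1+m)

  mate-exists : 2 * ones z ≤ N → ∀ {a} → at z a ≡ true → ∃[ b ] mate z a ≡ just b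
  mate-exists 2k≤N za =
    let d , sa = scan-exists 2k≤N za in _ , trans (mate-scan za) (cong (Maybe.map _) sa)

  closings-differ-inside : ∀ {a a′ d d′} → at z a′ ≡ true → scan a ≡ just d → scan a′ ≡ just d′ →
                         a < a′ → a′ < a + d → (a + d) % N ≢ (a′ + d′) % N
  closings-differ-inside {a} {a′} {d} {d′} za′ sa sa′ a<a′ a′<a+d eq =
    %-injective-window a′+d′<a+d a+d<a′+d′+N (sym eq)
    where
    e = a′ ∸ a
    a+e≡a′ : a + e ≡ a′
    a+e≡a′ = m+[n∸m]≡n (<⇒≤ a<a′)
    e+d′<d : e + d′ < d
    e+d′<d = scan-nested sa (m<n⇒0<n∸m a<a′) (+-cancelˡ-< a e d (subst (_< a + d) (sym a+e≡a′) a′<a+d))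
                         (subst (λ p → at z p ≡ true) (sym a+e≡a′) za′) (subst (λ p → scan p ≡ just d′) (sym a+e≡a′) sa′)
    a′+d′<a+d : a′ + d′ < a + d
    a′+d′<a+d = subst (λ p → p + d′ < a + d) a+e≡a′ (subst (_< a + d) (sym (+-assoc a e d′)) (+-monoʳ-< a e+d′<d))
    a+d<a′+d′+N : a + d < a′ + d′ + N
    a+d<a′+d′+N = <-≤-trans (+-monoʳ-< a (s≤s (proj₂ (scan-bounds sa))))
                            (+-monoˡ-≤ N (≤-trans (<⇒≤ a<a′) (m≤m+n a′ d′)))

  -- Either a′ lies inside the interval closed by a, or is its closing 0, or a + N lies
  -- inside the interval closed by a′, or the two intervals are disjoint.
  closings-differ : ∀ {a a′ d d′} → at z a ≡ true → at z a′ ≡ true → scan a ≡ just d → scan a′ ≡ just d′ →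
                    a < a′ → a′ < N → (a + d) % N ≢ (a′ + d′) % N
  closings-differ {a} {a′} {d} {d′} za za′ sa sa′ a<a′ a′<N with <-cmp a′ (a + d)
  ... | tri< a′<a+d _ _ = closings-differ-inside za′ sa sa′ a<a′ a′<a+d
  ... | tri≈ _ a′≡a+d _ with () ← trans (sym (scan-closes-at-zero sa)) (trans (cong (at z) (sym a′≡a+d)) za′)
  ... | tri> _ _ a+d<a′ with a + N <? a′ + d′
  ...   | yes a+N<a′+d′ = λ eq → wrapped (trans (sym eq) (sym ([a+N+d]%N≡[a+d]%N a d)))
    where
    wrapped : (a′ + d′) % N ≢ (a + N + d) % N
    wrapped = closings-differ-inside (trans (at-+N a) za) sa′ (trans (scan-+N a) sa)
                                   (<-≤-trans a′<N (m≤n+m N a)) a+N<a′+d′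
  ...   | no a+N≮a′+d′ = %-injective-window (<-≤-trans a+d<a′ (m≤m+n a′ d′))
                           (≤-<-trans (≮⇒≥ a+N≮a′+d′) (+-monoˡ-< N (m<m+n a (proj₁ (scan-bounds sa)))))

  mate-injective : ∀ {a a′ b} → a < N → a′ < N → mate z a ≡ just b → mate z a′ ≡ just b → a ≡ a′
  mate-injective {a} {a′} a<N a′<N ma ma′ with mate-just ma | mate-just ma′ | <-cmp a a′
  ... | za , d , sa , refl | za′ , d′ , sa′ , b≡ | tri< a<a′ _ _ = ⊥-elim (closings-differ za za′ sa sa′ a<a′ a′<N b≡)
  ... | _ | _ | tri≈ _ a≡a′ _ = a≡a′
  ... | za , d , sa , refl | za′ , d′ , sa′ , b≡ | tri> _ _ a′<a = ⊥-elim (closings-differ za′ za sa′ sa a′<a a<N (sym b≡))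

length-rotR1 : ∀ V → length (rotR1 V) ≡ length V
length-rotR1 [] = refl
length-rotR1 (v ∷ V) = CyclicWord.length-rotR1 (v ∷ V) refl

length-σ^ : ∀ i W → length (σ^ i W) ≡ length W
length-σ^ zero W = refl
length-σ^ (suc i) W = trans (length-rotR1 (σ^ i W)) (length-σ^ i W)

at-σ^ : ∀ i {W m} → length W ≡ suc m → ∀ t → at (σ^ i W) (t + i) ≡ at W t
at-σ^ zero {W} eq t = cong (at W) (+-identityʳ t)
at-σ^ (suc i) {W} eq t = begin
  at (rotR1 (σ^ i W)) (t + suc i)   ≡⟨ cong (at (rotR1 (σ^ i W))) (+-suc t i) ⟩
  at (rotR1 (σ^ i W)) (suc (t + i)) ≡⟨ CyclicWord.at-rotR1 (σ^ i W) (trans (length-σ^ i W) eq) (t + i) ⟩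
  at (σ^ i W) (t + i)               ≡⟨ at-σ^ i eq t ⟩
  at W t                            ∎
  where open ≡-Reasoning

nth-σ^ : ∀ i {W m} → length W ≡ suc m → ∀ {t} → t < suc m → nth (σ^ i W) ((t + i) % suc m) ≡ nth W t
nth-σ^ i {W} eq {t} t<N =
  trans (sym (CyclicWord.at-% (σ^ i W) (trans (length-σ^ i W) eq) (t + i))) (trans (at-σ^ i eq t) (CyclicWord.at-< W eq t<N))

-- Flipping matched bits

nth-map-upTo : ∀ (g : ℕ → Bool) L {p} → p < L → nth (map g (upTo L)) p ≡ g p
nth-map-upTo g L {p} p<L = trans (cong (λ w → nth w p) (map-upTo g L)) (nth-applyUpTo g L p<L)
  where
  nth-applyUpTo : ∀ (g : ℕ → Bool) L {p} → p < L → nth (applyUpTo g L) p ≡ g p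
  nth-applyUpTo g (suc L) {zero} _ = refl
  nth-applyUpTo g (suc L) {suc p} (s≤s p<L) = nth-applyUpTo (g ∘ suc) L p<L

length-f : ∀ z → length (f z) ≡ length z
length-f z = trans (length-map _ (upTo (length z))) (length-upTo (length z))

nth-f : ∀ z {p} → p < length z → nth (f z) p ≡ (if matchedB z p then not (nth z p) else nth z p)
nth-f z = nth-map-upTo _ (length z)

nth-f-unmatched : ∀ z {p} → Unmatched z p → nth (f z) p ≡ nth z p
nth-f-unmatched z {p} unmatched with p <? length z
... | yes p<L = trans (nth-f z p<L) (cong (λ b → if b then not (nth z p) else nth z p) unmatched)
... | no p≮L = trans (nth-≥ (f z) (subst (_≤ p) (sym (length-f z)) (≮⇒≥ p≮L))) (sym (nth-≥ z (≮⇒≥ p≮L)))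

nth-f-matched : ∀ z {p} → p < length z → matchedB z p ≡ true → nth (f z) p ≡ not (nth z p)
nth-f-matched z {p} p<L matched = trans (nth-f z p<L) (cong (λ b → if b then not (nth z p) else nth z p) matched)

hits-just : ∀ z {p a b} → mate z a ≡ just b → hits z p a ≡ (a ≡ᵇ p) ∨ (b ≡ᵇ p)
hits-just z ma rewrite ma | at-mate z ma = refl

hits-nothing : ∀ z {p a} → mate z a ≡ nothing → hits z p a ≡ false
hits-nothing z {p} {a} ma rewrite ma with at z a
... | true = refl
... | false = refl

hits-intro : ∀ z {p a b} → mate z a ≡ just b → a ≡ p ⊎ b ≡ p → T (hits z p a)
hits-intro z {p} {a} {b} ma a∨b =
  subst T (sym (hits-just z ma)) (Equivalence.from T-∨ (Sum.map (≡⇒≡ᵇ a p) (≡⇒≡ᵇ b p) a∨b))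

hits-elim : ∀ z {p a} → T (hits z p a) → ∃[ b ] mate z a ≡ just b × (a ≡ p ⊎ b ≡ p)
hits-elim z {p} {a} h = from-mate (mate z a) refl
  where
  from-mate : ∀ r → mate z a ≡ r → ∃[ b ] mate z a ≡ just b × (a ≡ p ⊎ b ≡ p)
  from-mate (just b) ma = b , ma , Sum.map (≡ᵇ⇒≡ a p) (≡ᵇ⇒≡ b p) (Equivalence.to T-∨ (subst T (hits-just z ma) h))
  from-mate nothing ma = ⊥-elim (subst T (hits-nothing z ma) h)

matchedB-intro : ∀ z {p a b} → a < length z → mate z a ≡ just b → a ≡ p ⊎ b ≡ p → matchedB z p ≡ true
matchedB-intro z {p} a<L ma a∨b =
  Equivalence.to T-≡ (any⁺ (hits z p) (lose (∈-upTo⁺ a<L) (hits-intro z ma a∨b)))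

matchedB-elim : ∀ z {p} → matchedB z p ≡ true → ∃[ a ] a < length z × ∃[ b ] mate z a ≡ just b × (a ≡ p ⊎ b ≡ p)
matchedB-elim z {p} matched with find (any⁻ (hits z p) (upTo (length z)) (Equivalence.from T-≡ matched))
... | a , a∈ , h = a , ∈-upTo⁻ a∈ , hits-elim z h

𝟙 : ∀ {p} {P : Set p} → Dec P → ℕ
𝟙 (yes _) = 1
𝟙 (no _) = 0

𝟙-yes : ∀ {p} {P : Set p} (P? : Dec P) → P → 𝟙 P? ≡ 1
𝟙-yes (yes _) _ = refl
𝟙-yes (no ¬P) P = ⊥-elim (¬P P)

𝟙-no : ∀ {p} {P : Set p} (P? : Dec P) → ¬ P → 𝟙 P? ≡ 0
𝟙-no (yes P) ¬P = ⊥-elim (¬P P)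
𝟙-no (no _) _ = refl

∑-𝟙-none : ∀ {p n} {P : Fin n → Set p} (P? : U.Decidable P) → (∀ j → ¬ P j) → ∑[ j < n ] 𝟙 (P? j) ≡ 0
∑-𝟙-none {n = n} P? ¬P = trans (sum-cong-≗ (λ j → 𝟙-no (P? j) (¬P j))) (sum-replicate-zero n)

∑-𝟙-single : ∀ {p n} {P : Fin n → Set p} (P? : U.Decidable P) {j₀} → P j₀ → (∀ {j} → P j → j ≡ j₀) →
             ∑[ j < n ] 𝟙 (P? j) ≡ 1
∑-𝟙-single P? {Fin.zero} Pj₀ unique =
  cong₂ _+_ (𝟙-yes (P? Fin.zero) Pj₀) (∑-𝟙-none (P? ∘ Fin.suc) λ j Pj → case unique Pj of λ ())
∑-𝟙-single P? {Fin.suc j₀} Pj₀ unique =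
  cong₂ _+_ (𝟙-no (P? Fin.zero) λ P0 → case unique P0 of λ ())
            (∑-𝟙-single (P? ∘ Fin.suc) Pj₀ λ Pj → FinP.suc-injective (unique Pj))

∑-𝟙-atMostOne : ∀ {p q n} {P : Fin n → Set p} {Q : Set q} (P? : U.Decidable P) →
                (∀ {i j} → P i → P j → i ≡ j) → (Q? : Dec Q) → Q ⇔ ∃ P → ∑[ j < n ] 𝟙 (P? j) ≡ 𝟙 Q?
∑-𝟙-atMostOne P? unique Q? Q⇔∃P with Q?
... | yes Q = let j₀ , Pj₀ = Equivalence.to Q⇔∃P Q in ∑-𝟙-single P? Pj₀ λ Pj → unique Pj Pj₀
... | no ¬Q = ∑-𝟙-none P? λ j Pj → ¬Q (Equivalence.from Q⇔∃P (j , Pj))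

ones-∑ : ∀ z → ones z ≡ ∑[ i < length z ] 𝟙 (nth z (Fin.toℕ i) Bool.≟ true)
ones-∑ [] = refl
ones-∑ (true ∷ z) = cong suc (ones-∑ z)
ones-∑ (false ∷ z) = ones-∑ z

∃<⇔∃Fin : ∀ {p n} {P : ℕ → Set p} → (∃[ a ] a < n × P a) ⇔ (∃[ i ] P (Fin.toℕ {n} i))
∃<⇔∃Fin {P = P} = mk⇔ (λ (a , a<n , Pa) → Fin.fromℕ< a<n , subst P (sym (toℕ-fromℕ< a<n)) Pa)
                      (λ (i , Pi) → Fin.toℕ i , toℕ<n i , Pi)

module SparseWord (z : List Bool) {m k : ℕ} (z∈X : X (suc m) k z) (2k≤n : 2 * k ≤ suc m) where

  length-z : length z ≡ suc m
  length-z = proj₁ z∈X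

  open CyclicWord z length-z

  2k≤N : 2 * ones z ≤ N
  2k≤N = subst (λ k → 2 * k ≤ N) (sym (proj₂ z∈X)) 2k≤n

  matched-at-one : ∀ {p} → nth z p ≡ true → matchedB z p ≡ true
  matched-at-one {p} zp =
    let b , mp = mate-exists 2k≤N (trans (at-< (subst (p <_) length-z (nth-true⇒< z zp))) zp)
    in matchedB-intro z (nth-true⇒< z zp) mp (inj₁ refl)

  f-at-one : ∀ {p} → nth z p ≡ true → nth (f z) p ≡ false
  f-at-one zp = trans (nth-f-matched z (nth-true⇒< z zp) (matched-at-one zp)) (cong not zp)

  f-one⇔mate-target : ∀ {p} → p < N → nth (f z) p ≡ true ⇔ (∃[ a ] a < N × mate z a ≡ just p)
  f-one⇔mate-target {p} p<N = mk⇔ to from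
    where
    p<L = subst (p <_) (sym length-z) p<N
    to : nth (f z) p ≡ true → ∃[ a ] a < N × mate z a ≡ just p
    to fp with nth z p Bool.≟ true | matchedB z p Bool.≟ true
    ... | yes zp | _ with () ← trans (sym (f-at-one zp)) fp
    ... | no zp | no unmatched with () ← trans (sym (trans (nth-f-unmatched z (¬-not unmatched)) (¬-not zp))) fp
    ... | no zp | yes matched with matchedB-elim z matched
    ...   | a , a<L , b , ma , inj₂ refl = a , subst (a <_) length-z a<L , ma
    ...   | a , a<L , b , ma , inj₁ refl with () ← trans (sym (¬-not zp)) (trans (sym (at-< p<N)) (at-mate z ma))
    from : ∃[ a ] a < N × mate z a ≡ just p → nth (f z) p ≡ true
    from (a , a<N , ma) = trans (nth-f-matched z p<L (matchedB-intro z (subst (a <_) (sym length-z) a<N) ma (inj₂ refl)))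
                                (cong not (proj₂ (mate-target ma)))

  Mates : Fin N → Fin N → Set
  Mates a p = mate z (Fin.toℕ a) ≡ just (Fin.toℕ p)

  mates? : ∀ a p → Dec (Mates a p)
  mates? a p = ≡-dec _≟_ (mate z (Fin.toℕ a)) (just (Fin.toℕ p))

  row-count : ∀ a → ∑[ p < N ] 𝟙 (mates? a p) ≡ 𝟙 (nth z (Fin.toℕ a) Bool.≟ true)
  row-count a = ∑-𝟙-atMostOne (mates? a) (λ ma ma′ → toℕ-injective (just-injective (trans (sym ma) ma′))) _ (mk⇔ to from)
    where
    to : nth z (Fin.toℕ a) ≡ true → ∃ (Mates a)
    to za = let b , ma = mate-exists 2k≤N (trans (at-< (toℕ<n a)) za)
            in Equivalence.to (∃<⇔∃Fin {P = λ b → mate z (Fin.toℕ a) ≡ just b}) (b , proj₁ (mate-target ma) , ma)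
    from : ∃ (Mates a) → nth z (Fin.toℕ a) ≡ true
    from (_ , ma) = trans (sym (at-< (toℕ<n a))) (at-mate z ma)

  column-count : ∀ p → ∑[ a < N ] 𝟙 (mates? a p) ≡ 𝟙 (nth (f z) (Fin.toℕ p) Bool.≟ true)
  column-count p = ∑-𝟙-atMostOne (λ a → mates? a p)
                     (λ ma ma′ → toℕ-injective (mate-injective (toℕ<n _) (toℕ<n _) ma ma′)) _
                     (∃<⇔∃Fin ⇔-∘ f-one⇔mate-target (toℕ<n p))

  -- Double counting of matched pairs: each 1 of z opens exactly one, each 1 of f z closes exactly one.
  ones-f : ones (f z) ≡ ones z
  ones-f = begin
    ones (f z)                                              ≡⟨ ones-∑ (f z) ⟩
    ∑[ p < length (f z) ] 𝟙 (nth (f z) (Fin.toℕ p) Bool.≟ true)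
      ≡⟨ cong (λ L → ∑[ p < L ] 𝟙 (nth (f z) (Fin.toℕ p) Bool.≟ true)) (trans (length-f z) length-z) ⟩
    ∑[ p < N ] 𝟙 (nth (f z) (Fin.toℕ p) Bool.≟ true)        ≡⟨ sum-cong-≗ column-count ⟨
    ∑[ p < N ] ∑[ a < N ] 𝟙 (mates? a p)                    ≡⟨ ∑-comm (λ p a → 𝟙 (mates? a p)) ⟩
    ∑[ a < N ] ∑[ p < N ] 𝟙 (mates? a p)                    ≡⟨ sum-cong-≗ row-count ⟩
    ∑[ a < N ] 𝟙 (nth z (Fin.toℕ a) Bool.≟ true)            ≡⟨ cong (λ L → ∑[ a < L ] 𝟙 (nth z (Fin.toℕ a) Bool.≟ true)) length-z ⟨
    ∑[ a < length z ] 𝟙 (nth z (Fin.toℕ a) Bool.≟ true)     ≡⟨ ones-∑ z ⟨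
    ones z                                                  ∎
    where open ≡-Reasoning

  adjacent-f : ∀ y → (∀ {q} → nth y q ≡ true → nth z q ≡ true ⊎ Unmatched z q × nth z q ≡ false) → Adjacent (f z) y
  adjacent-f y y-ones q (fq , yq) with y-ones yq
  ... | inj₁ zq with () ← trans (sym (f-at-one zq)) fq
  ... | inj₂ (unmatched , zq) with () ← trans (sym (trans (nth-f-unmatched z unmatched) zq)) fq

  f∈X : X (suc m) k (f z)
  f∈X = trans (length-f z) length-z , trans ones-f (proj₂ z∈X)

  adjacent-self : Adjacent z (f z)
  adjacent-self p (zp , fp) = adjacent-f z inj₁ p (fp , zp)

  f-at-mate : ∀ {a b} → a < length z → mate z a ≡ just b → nth (f z) b ≡ true
  f-at-mate a<L ma =
    Equivalence.from (f-one⇔mate-target (proj₁ (mate-target ma))) (_ , subst (_ <_) length-z a<L , ma)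

-- Connectors

module ConnectorWords {m i : ℕ} (P Q R u w : List Bool) {x y : List Bool}
  (length-x : length x ≡ suc m) (length-y : length y ≡ suc m)
  (x≡ : x ≡ σ^ i (P ++ true ∷ u ++ false ∷ Q ++ false ∷ w ++ false ∷ R))
  (y≡ : y ≡ σ^ i (P ++ false ∷ u ++ false ∷ Q ++ true ∷ w ++ false ∷ R)) where

  open Modular m using (N; shift-surjective)

  s : ℕ → ℕ
  s p = (p + i) % N

  p1 p2 p3 : ℕ
  p1 = length P
  p2 = p1 + 1 + length u
  p3 = p2 + 1 + length Q

  -- The unrotated words, regrouped so that they visibly differ only at p1 and p3.
  B C W W′ : List Bool
  B = u ++ false ∷ Q
  C = w ++ false ∷ R
  W = P ++ true ∷ B ++ false ∷ C
  W′ = P ++ false ∷ B ++ true ∷ C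

  B-assoc : ∀ {b c} → P ++ b ∷ B ++ c ∷ C ≡ P ++ b ∷ u ++ false ∷ Q ++ c ∷ C
  B-assoc = cong (λ v → P ++ _ ∷ v) (++-assoc u (false ∷ Q) (_ ∷ C))

  length-W : length W ≡ N
  length-W = trans (sym (length-σ^ i W)) (trans (cong (length ∘ σ^ i) B-assoc) (trans (cong length (sym x≡)) length-x))

  length-W′ : length W′ ≡ N
  length-W′ = trans (sym (length-σ^ i W′)) (trans (cong (length ∘ σ^ i) B-assoc) (trans (cong length (sym y≡)) length-y))

  x-at : ∀ {t} → t < N → nth x (s t) ≡ nth W t
  x-at {t} t<N = trans (cong (λ v → nth v (s t)) (trans x≡ (cong (σ^ i) (sym B-assoc)))) (nth-σ^ i length-W t<N)

  y-at : ∀ {t} → t < N → nth y (s t) ≡ nth W′ t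
  y-at {t} t<N = trans (cong (λ v → nth v (s t)) (trans y≡ (cong (σ^ i) (sym B-assoc)))) (nth-σ^ i length-W′ t<N)

  p2≡ : p2 ≡ suc (p1 + length u)
  p2≡ = cong (_+ length u) (+-comm p1 1)

  p3≡ : p3 ≡ suc (p1 + length B)
  p3≡ = trans (+-suc-+-suc p1 (length u) (length Q)) (cong (λ l → suc (p1 + l)) (sym (length-++ u)))
    where
    +-suc-+-suc : ∀ a b c → a + 1 + b + 1 + c ≡ suc (a + (b + suc c))
    +-suc-+-suc = solve-∀

  W-p1 : nth W p1 ≡ true
  W-p1 = nth-at-length P _

  W′-p1 : nth W′ p1 ≡ false
  W′-p1 = nth-at-length P _

  W′-p2 : nth W′ p2 ≡ false
  W′-p2 = trans (cong₂ nth B-assoc p2≡) (nth-at-length₂ P u _)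

  W-p3 : nth W p3 ≡ false
  W-p3 = trans (cong (nth W) p3≡) (nth-at-length₂ P B C)

  W′-p3 : nth W′ p3 ≡ true
  W′-p3 = trans (cong (nth W′) p3≡) (nth-at-length₂ P B C)

  p1<N : p1 < N
  p1<N = subst (p1 <_) length-W (nth-true⇒< W W-p1)

  p3<N : p3 < N
  p3<N = subst (p3 <_) length-W′ (nth-true⇒< W′ W′-p3)

  p2<N : p2 < N
  p2<N = ≤-<-trans (≤-trans (m≤m+n p2 1) (m≤m+n (p2 + 1) (length Q))) p3<N

  x-p1 : nth x (s p1) ≡ true
  x-p1 = trans (x-at p1<N) W-p1

  y-p1 : nth y (s p1) ≡ false
  y-p1 = trans (y-at p1<N) W′-p1

  y-p2 : nth y (s p2) ≡ false
  y-p2 = trans (y-at p2<N) W′-p2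

  x-p3 : nth x (s p3) ≡ false
  x-p3 = trans (x-at p3<N) W-p3

  ones-of-y : ∀ {q} → nth y q ≡ true → nth x q ≡ true ⊎ q ≡ s p3
  ones-of-y {q} yq with shift-surjective i (subst (q <_) length-y (nth-true⇒< y yq))
  ... | t , t<N , refl with nth-edit₂ P B C {true} {false} {false} {true} t
  ...   | inj₁ refl with () ← trans (sym W′-p1) (trans (sym (y-at t<N)) yq)
  ...   | inj₂ (inj₁ t≡p3) = inj₂ (cong s (trans t≡p3 (sym p3≡)))
  ...   | inj₂ (inj₂ W≡W′) = inj₁ (trans (x-at t<N) (trans W≡W′ (trans (sym (y-at t<N)) yq)))

  ones-of-x : ∀ {q} → nth x q ≡ true → nth y q ≡ true ⊎ q ≡ s p1
  ones-of-x {q} xq with shift-surjective i (subst (q <_) length-x (nth-true⇒< x xq))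
  ... | t , t<N , refl with nth-edit₂ P B C {true} {false} {false} {true} t
  ...   | inj₁ refl = inj₂ refl
  ...   | inj₂ (inj₁ t≡p3) with () ← trans (sym W-p3) (trans (cong (nth W) (trans p3≡ (sym t≡p3))) (trans (sym (x-at t<N)) xq))
  ...   | inj₂ (inj₂ W≡W′) = inj₁ (trans (y-at t<N) (trans (sym W≡W′) (trans (sym (x-at t<N)) xq)))

one-exists : ∀ z → 1 ≤ ones z → ∃[ p ] nth z p ≡ true
one-exists (true ∷ z) _ = 0 , refl
one-exists (false ∷ z) 1≤ones = let p , zp = one-exists z 1≤ones in suc p , zp

adjacent⇒≢ : ∀ {a b} → 1 ≤ ones a → Adjacent a b → a ≢ b
adjacent⇒≢ {a} 1≤ones adj refl = let p , ap = one-exists a 1≤ones in adj p (ap , ap)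

differ-at : ∀ {a b p} → nth a p ≡ true → nth b p ≡ false → a ≢ b
differ-at ap bp refl with () ← trans (sym bp) ap

-- Kneser graphs have no loops, so only the two diagonals need to be shown distinct.
four-cycle : ∀ {n k a b c d} → 1 ≤ k → X n k a → X n k b → X n k c → X n k d →
             Adjacent a b → Adjacent b c → Adjacent c d → Adjacent d a → a ≢ c → b ≢ d →
             FourCycle n k a b c d
four-cycle {n} {k} {a} {b} {c} {d} 1≤k a∈X b∈X c∈X d∈X a~b b~c c~d d~a a≢c b≢d =
  (a∈X , b∈X , c∈X , d∈X) ,
  (adjacent⇒≢ (has-one a a∈X) a~b , a≢c , (λ a≡d → adjacent⇒≢ (has-one d d∈X) d~a (sym a≡d)) ,
   adjacent⇒≢ (has-one b b∈X) b~c , b≢d , adjacent⇒≢ (has-one c c∈X) c~d) ,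
  (a~b , b~c , c~d , d~a)
  where
  has-one : ∀ v → X n k v → 1 ≤ ones v
  has-one _ (_ , ones-v) = subst (1 ≤_) (sym ones-v) 1≤k

lemma32 : (n k : ℕ) → 1 ≤ k → 2 * k + 1 ≤ n →
    (x y : List Bool) → Connector n k x y →
    FourCycle n k x (f x) y (f y)
lemma32 zero k _ 2k+1≤0 = case ≤-trans (m≤n+m 1 (2 * k)) 2k+1≤0 of λ ()
lemma32 (suc m) k 1≤k 2k+1≤n x y
  (x∈X , y∈X , i , P , Q , R , u , w , _ , _ , x≡ , y≡ ,
   ((p1<n , _ , mate-p1) , _) , unmatched-x-p3 , _ , unmatched-y-p1 , unmatched-y-p2 , _) =
  four-cycle 1≤k x∈X X.f∈X y∈X Y.f∈X X.adjacent-self fx~y Y.adjacent-self fy~x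
             (differ-at x-p1 y-p1) (differ-at (X.f-at-mate p1<n mate-p1) fy-p2)
  where
  open ConnectorWords {i = i} P Q R u w (proj₁ x∈X) (proj₁ y∈X) x≡ y≡
  2k≤n : 2 * k ≤ suc m
  2k≤n = ≤-trans (m≤m+n (2 * k) 1) 2k+1≤n
  module X = SparseWord x x∈X 2k≤n
  module Y = SparseWord y y∈X 2k≤n
  fx~y : Adjacent (f x) y
  fx~y = X.adjacent-f y λ yq → Sum.map₂ (λ { refl → unmatched-x-p3 , x-p3 }) (ones-of-y yq)
  fy~x : Adjacent (f y) x
  fy~x = Y.adjacent-f x λ xq → Sum.map₂ (λ { refl → unmatched-y-p1 , y-p1 }) (ones-of-x xq)
  fy-p2 : nth (f y) (s p2) ≡ false
  fy-p2 = trans (nth-f-unmatched y unmatched-y-p2) y-p2
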